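{- For every connected $n$-vertex graph $G$, $\operatorname{av}(S_n) \leq \operatorname{av}(G)$, with equality only if $G$ is a star.
   Context: A matching of a graph is a set of pairwise vertex-disjoint edges; $m(G,k)$ denotes the number of matchings of cardinality $k$ in $G$, and $\operatorname{av}(G)=\frac{\sum_{k\ge0}k\,m(G,k)}{\sum_{k\ge0}m(G,k)}$ is the average size of a matching of $G$ (the empty matching included). $S_n$ is the star on $n$ vertices, for which $\operatorname{av}(S_n)=\frac{n-1}{n}$. -}

module Defs where

open import Data.Bool using (Bool; true; false; if_then_else_; _∧_; not)
open import Data.Nat using (ℕ; zero; suc; _+_; _<ᵇ_; NonZero)
open import Data.Fin using (Fin; toℕ; _≟_)
open import Data.List using (List; []; _∷_; _++_; map; filter; length; concatMap; allFin)
open import Data.Nat.ListAction using (sum)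
open import Data.List.Relation.Unary.All using (All)
open import Data.Product using (_×_; _,_; proj₁; proj₂; Σ; ∃)
open import Data.Integer using (+_)
open import Data.Rational using (ℚ; _/_)
open import Relation.Nullary.Decidable using (⌊_⌋)
open import Relation.Binary.PropositionalEquality using (_≡_; _≢_; refl)

record Graph (n : ℕ) : Set where
  field
    adj    : Fin n → Fin n → Bool
    sym    : ∀ u v → adj u v ≡ adj v u
    irrefl : ∀ v → adj v v ≡ false
open Graph public

Edge : ℕ → Set
Edge n = Fin n × Fin n

edges : ∀ {n} → Graph n → List (Edge n)
edges {n} G =
  concatMap (λ u → concatMap (λ v →
      if (toℕ u <ᵇ toℕ v) ∧ adj G u v then (u , v) ∷ [] else [])
    (allFin n)) (allFin n)

disjointᵇ : ∀ {n} → Edge n → Edge n → Bool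
disjointᵇ (a , b) (c , d) =
  not (⌊ a ≟ c ⌋) ∧ not (⌊ a ≟ d ⌋) ∧ not (⌊ b ≟ c ⌋) ∧ not (⌊ b ≟ d ⌋)

disjointAllᵇ : ∀ {n} → Edge n → List (Edge n) → Bool
disjointAllᵇ e []       = true
disjointAllᵇ e (f ∷ fs) = disjointᵇ e f ∧ disjointAllᵇ e fs

-- All matchings (sets of pairwise vertex-disjoint edges) drawn from a list
-- of distinct edges, each listed exactly once (empty matching included).
matchingsOf : ∀ {n} → List (Edge n) → List (List (Edge n))
matchingsOf []       = [] ∷ []
matchingsOf (e ∷ es) =
  matchingsOf es ++ map (e ∷_) (filter (λ M → disjointAllᵇ e M ≡? true) (matchingsOf es))
  where
    open import Data.Bool.Properties using () renaming (_≟_ to _≡?_)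

matchings : ∀ {n} → Graph n → List (List (Edge n))
matchings G = matchingsOf (edges G)

numMatchings : ∀ {n} → Graph n → ℕ
numMatchings G = length (matchings G)

totalMatchingSize : ∀ {n} → Graph n → ℕ
totalMatchingSize G = sum (map length (matchings G))

numMatchingsOf-nonZero : ∀ {n} (es : List (Edge n)) → NonZero (length (matchingsOf es))
numMatchingsOf-nonZero []       = _
numMatchingsOf-nonZero (e ∷ es) = lemma (matchingsOf es) _ (numMatchingsOf-nonZero es)
  where
    open import Data.Nat using (nonZero)
    lemma : ∀ {A : Set} (xs ys : List A) → NonZero (length xs) → NonZero (length (xs ++ ys))
    lemma (x ∷ xs) ys _ = _

av : ∀ {n} → Graph n → ℚ
av G = _/_ (+ totalMatchingSize G) (numMatchings G) {{numMatchingsOf-nonZero (edges G)}}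

data Walk {n} (G : Graph n) : Fin n → Fin n → Set where
  here : ∀ {v} → Walk G v v
  step : ∀ {u v w} → adj G u v ≡ true → Walk G v w → Walk G u w

Connected : ∀ {n} → Graph n → Set
Connected {n} G = (u v : Fin n) → Walk G u v

IsStar : ∀ {n} → Graph n → Set
IsStar {n} G = Σ (Fin n) λ c →
  ((v : Fin n) → v ≢ c → adj G c v ≡ true) ×
  ((u v : Fin n) → adj G u v ≡ true → (u ≡ c) Data.Sum.⊎ (v ≡ c))
  where import Data.Sum

starAdj : ∀ {k} → Fin (suc k) → Fin (suc k) → Bool
starAdj Fin.zero Fin.zero    = false
starAdj Fin.zero (Fin.suc _) = true
starAdj (Fin.suc _) Fin.zero = true
starAdj (Fin.suc _) (Fin.suc _) = false

star : (n : ℕ) → .{{NonZero n}} → Graph n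
star (suc k) = record { adj = starAdj ; sym = s ; irrefl = i }
  where
    s : ∀ u v → starAdj u v ≡ starAdj v u
    s Fin.zero Fin.zero = refl
    s Fin.zero (Fin.suc _) = refl
    s (Fin.suc _) Fin.zero = refl
    s (Fin.suc _) (Fin.suc _) = refl
    i : ∀ v → starAdj v v ≡ false
    i Fin.zero = refl
    i (Fin.suc _) = refl

-- Let E be the number of edges of G, and m and t the number and the total size of its nonempty
-- matchings, so that av G = t / (1 + m). The E single edges give m ≥ E, and every other nonempty
-- matching has at least two edges, so 2m ≤ E + t. For n = k + 1 vertices this already gives
-- k / (k + 1) < t / (1 + m) unless m = E, that is, unless the edges pairwise intersect; then
-- t = E and the claim becomes k ≤ E. In a connected graph with pairwise intersecting edges fix an
-- edge ab: every vertex w ≠ a is adjacent to a or to b, and the edges joining each such w to a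
-- chosen neighbour in {a, b} are pairwise distinct. So E ≥ k, and if E = k these k edges are all
-- the edges, which forces a star.
module Submission where

-- Kept in its own module so that ℕ's _≤_ is out of scope below, where _≤_ is ℚ's.
module AverageMatchingSize where

  open import Defs hiding (sym)
  open import Data.Bool using (true; false; _∧_; if_then_else_)
  open import Data.Bool.Properties using (_≟_; T-≡; not-¬; ∧-zeroʳ)
  open import Data.Empty using (⊥-elim)
  open import Data.Fin as F using (Fin)
  import Data.Fin.Properties as F
  open import Data.List
    using ( List; []; _∷_; _++_; [_]; map; filter; length; reverse; _∷ʳ_
          ; allFin; lookup; tabulate; concatMap )
  open import Data.List.Properties
    using ( ++-identityʳ; map-++; length-++; length-map; length-reverse; length-tabulate
          ; unfold-reverse; filter-none )
  open import Data.List.Membership.Propositional using (_∈_)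
  open import Data.List.Membership.Propositional.Properties
    using (∈-++⁺ˡ; ∈-++⁺ʳ; ∈-filter⁺; ∈-length; ∈-concatMap⁺; ∈-allFin; ∈-AllPairs₂)
  open import Data.List.Relation.Unary.All as All using (All; []; _∷_)
  import Data.List.Relation.Unary.All.Properties as All
  open import Data.List.Relation.Unary.AllPairs using (AllPairs; []; _∷_)
  import Data.List.Relation.Unary.AllPairs.Properties as AllPairs
  import Data.List.Relation.Unary.Any as Any
  open import Data.List.Relation.Unary.Any using (here; there)
  open import Data.List.Relation.Unary.Any.Properties using (lookup-index; reverse⁻)
  open import Data.Nat using (ℕ; zero; suc; _+_; _*_; _≤_; _<_; _<ᵇ_; z≤n; s≤s; s≤s⁻¹; NonZero)
  open import Data.Nat.Properties
    using ( module ≤-Reasoning; _≤?_; ≤-refl; ≤-reflexive; ≤-trans; ≤-antisym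
          ; <⇒≤; <⇒≢; <⇒≱; ≰⇒>; ≤-<-trans
          ; <⇒<ᵇ; +-suc; +-identityʳ; *-suc; *-comm; m<m+n; m<n+m; m≤n+m; m+n≤o⇒m≤o
          ; +-mono-≤; +-monoˡ-≤; +-monoʳ-≤; +-monoˡ-<; +-cancelˡ-≤; +-cancelʳ-≤; +-cancelˡ-<
          ; *-monoˡ-≤; *-monoʳ-≤ )
  open import Data.Nat.ListAction using (sum)
  open import Data.Nat.ListAction.Properties using (sum-++)
  open import Data.Nat.Tactic.RingSolver using (solve-∀)
  open import Data.Product using (_×_; _,_; proj₁; proj₂; ∃-syntax)
  open import Data.Sum as Sum using (_⊎_; inj₁; inj₂)
  import Data.Integer as ℤ
  import Data.Integer.Properties as ℤ
  import Data.Rational as ℚ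
  open import Data.Rational.Properties using (toℚᵘ-cancel-≤; toℚᵘ-fromℚᵘ; normalize-injective-≃)
  import Data.Rational.Unnormalised as ℚᵘ
  import Data.Rational.Unnormalised.Properties as ℚᵘ
  open import Function using (_∘_; Equivalence; Injective)
  open import Relation.Binary using (tri<; tri≈; tri>)
  open import Relation.Binary.PropositionalEquality hiding ([_])
  open import Relation.Nullary using (yes; no; ¬?; _×-dec_)
  open import Relation.Unary using (Decidable)

  private variable
    A : Set
    n : ℕ

  Σlength : List (List A) → ℕ
  Σlength Ms = sum (map length Ms)

  Σlength-++ : (Ms Ns : List (List A)) → Σlength (Ms ++ Ns) ≡ Σlength Ms + Σlength Ns
  Σlength-++ Ms Ns = trans (cong sum (map-++ length Ms Ns)) (sum-++ (map length Ms) _)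

  Σlength-map-∷ : (x : A) (Ms : List (List A)) → Σlength (map (x ∷_) Ms) ≡ length Ms + Σlength Ms
  Σlength-map-∷ x []       = refl
  Σlength-map-∷ x (M ∷ Ms) =
    trans (cong (suc (length M) +_) (Σlength-map-∷ x Ms)) (shuffle (length M) (length Ms) (Σlength Ms))
    where
      shuffle : ∀ a b c → suc a + (b + c) ≡ suc b + (a + c)
      shuffle = solve-∀

  Σlength-singletons : (xs : List A) → Σlength (map [_] xs) ≡ length xs
  Σlength-singletons []       = refl
  Σlength-singletons (x ∷ xs) = cong suc (Σlength-singletons xs)

  length≤Σlength : {Ms : List (List A)} → All (_≢ []) Ms → length Ms ≤ Σlength Ms
  length≤Σlength {Ms = []}          []          = z≤n
  length≤Σlength {Ms = [] ∷ _}      (M≢[] ∷ _)  = ⊥-elim (M≢[] refl)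
  length≤Σlength {Ms = (_ ∷ M) ∷ _} (_ ∷ Ms≢[]) =
    s≤s (≤-trans (length≤Σlength Ms≢[]) (m≤n+m _ (length M)))

  compatible? : (e : Edge n) → Decidable (λ M → disjointAllᵇ e M ≡ true)
  compatible? e M = disjointAllᵇ e M ≟ true

  nonemptyMatchingsOf : List (Edge n) → List (List (Edge n))
  nonemptyMatchingsOf []       = []
  nonemptyMatchingsOf (e ∷ es) =
    nonemptyMatchingsOf es ++ [ e ] ∷ map (e ∷_) (filter (compatible? e) (nonemptyMatchingsOf es))

  matchingsOf≡[]∷nonempty : (es : List (Edge n)) → matchingsOf es ≡ [] ∷ nonemptyMatchingsOf es
  matchingsOf≡[]∷nonempty []       = refl
  matchingsOf≡[]∷nonempty (e ∷ es) rewrite matchingsOf≡[]∷nonempty es = refl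

  extensions : Edge n → List (Edge n) → List (List (Edge n))
  extensions e es = filter (compatible? e) (nonemptyMatchingsOf es)

  nonemptyCount : List (Edge n) → ℕ
  nonemptyCount es = length (nonemptyMatchingsOf es)

  nonemptySize : List (Edge n) → ℕ
  nonemptySize es = Σlength (nonemptyMatchingsOf es)

  nonemptyCount-∷ : (e : Edge n) (es : List (Edge n)) →
    nonemptyCount (e ∷ es) ≡ nonemptyCount es + suc (length (extensions e es))
  nonemptyCount-∷ e es = trans (length-++ (nonemptyMatchingsOf es))
    (cong (λ l → nonemptyCount es + suc l) (length-map (e ∷_) (extensions e es)))

  nonemptySize-∷ : (e : Edge n) (es : List (Edge n)) →
    nonemptySize (e ∷ es) ≡ nonemptySize es + suc (length (extensions e es) + Σlength (extensions e es))
  nonemptySize-∷ e es = trans (Σlength-++ (nonemptyMatchingsOf es) _)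
    (cong (λ s → nonemptySize es + suc s) (Σlength-map-∷ e (extensions e es)))

  nonemptyMatchings-nonempty : (es : List (Edge n)) → All (_≢ []) (nonemptyMatchingsOf es)
  nonemptyMatchings-nonempty []       = []
  nonemptyMatchings-nonempty (e ∷ es) =
    All.++⁺ (nonemptyMatchings-nonempty es) ((λ ()) ∷ All.map⁺ (All.universal (λ _ ()) _))

  singleton∈nonemptyMatchingsOf : {f : Edge n} (es : List (Edge n)) →
    f ∈ es → [ f ] ∈ nonemptyMatchingsOf es
  singleton∈nonemptyMatchingsOf (e ∷ es) (here refl) = ∈-++⁺ʳ (nonemptyMatchingsOf es) (here refl)
  singleton∈nonemptyMatchingsOf (e ∷ es) (there f∈)  = ∈-++⁺ˡ (singleton∈nonemptyMatchingsOf es f∈)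

  length≤nonemptyCount : (es : List (Edge n)) → length es ≤ nonemptyCount es
  length≤nonemptyCount []       = z≤n
  length≤nonemptyCount (e ∷ es) = begin
    suc (length es)                                   ≤⟨ s≤s (length≤nonemptyCount es) ⟩
    suc (nonemptyCount es)                            ≤⟨ m<m+n (nonemptyCount es) (s≤s z≤n) ⟩
    nonemptyCount es + suc (length (extensions e es)) ≡⟨ nonemptyCount-∷ e es ⟨
    nonemptyCount (e ∷ es)                            ∎
    where open ≤-Reasoning

  -- Each new matching [ e ] is paid for by the new edge, each e ∷ M by the edges of M.
  nonemptyCount-double≤ : (es : List (Edge n)) →
    nonemptyCount es + nonemptyCount es ≤ length es + nonemptySize es
  nonemptyCount-double≤ []       = z≤n
  nonemptyCount-double≤ (e ∷ es) = begin
    nonemptyCount (e ∷ es) + nonemptyCount (e ∷ es)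
      ≡⟨ cong₂ _+_ (nonemptyCount-∷ e es) (nonemptyCount-∷ e es) ⟩
    (m + suc f) + (m + suc f)
      ≡⟨ regroupˡ m f ⟩
    (m + m) + suc (suc (f + f))
      ≤⟨ +-mono-≤ (nonemptyCount-double≤ es) (s≤s (s≤s (+-monoʳ-≤ f f≤s))) ⟩
    (length es + t) + suc (suc (f + s))
      ≡⟨ regroupʳ (length es) t f s ⟩
    suc (length es) + (t + suc (f + s))
      ≡⟨ cong (suc (length es) +_) (nonemptySize-∷ e es) ⟨
    suc (length es) + nonemptySize (e ∷ es) ∎
    where
      open ≤-Reasoning
      m = nonemptyCount es
      t = nonemptySize es
      f = length (extensions e es)
      s = Σlength (extensions e es)
      f≤s : f ≤ s
      f≤s = length≤Σlength (All.filter⁺ (compatible? e) (nonemptyMatchings-nonempty es))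
      regroupˡ : ∀ m f → (m + suc f) + (m + suc f) ≡ (m + m) + suc (suc (f + f))
      regroupˡ = solve-∀
      regroupʳ : ∀ l t f s → (l + t) + suc (suc (f + s)) ≡ suc l + (t + suc (f + s))
      regroupʳ = solve-∀

  Intersecting : List (Edge n) → Set
  Intersecting = AllPairs (λ e f → disjointᵇ e f ≡ false)

  nonemptyCount≤length⇒Intersecting : (es : List (Edge n)) →
    nonemptyCount es ≤ length es → Intersecting es
  nonemptyCount≤length⇒Intersecting []       _ = []
  nonemptyCount≤length⇒Intersecting (e ∷ es) h =
    All.tabulate e-meets ∷ nonemptyCount≤length⇒Intersecting es (m+n≤o⇒m≤o m m+f≤l)
    where
      m = nonemptyCount es
      m+f≤l : m + length (extensions e es) ≤ length es
      m+f≤l = s≤s⁻¹ (subst (_≤ suc (length es)) (trans (nonemptyCount-∷ e es) (+-suc m _)) h)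
      no-extensions : length (extensions e es) ≤ 0
      no-extensions = +-cancelˡ-≤ m _ 0
        (≤-trans m+f≤l (≤-trans (length≤nonemptyCount es) (≤-reflexive (sym (+-identityʳ m)))))
      e-meets : ∀ {f} → f ∈ es → disjointᵇ e f ≡ false
      e-meets {f} f∈ with disjointᵇ e f in disjoint
      ... | false = refl
      ... | true  = ⊥-elim (<⇒≱ (∈-length [f]∈extensions) no-extensions)
        where
          [f]∈extensions : [ f ] ∈ extensions e es
          [f]∈extensions =
            ∈-filter⁺ (compatible? e) (singleton∈nonemptyMatchingsOf es f∈) (cong (_∧ true) disjoint)

  singleton-incompatible : {e f : Edge n} → disjointᵇ e f ≡ false → disjointAllᵇ e [ f ] ≢ true
  singleton-incompatible meets rewrite meets = λ ()

  Intersecting⇒nonemptyMatchingsOf≡singletons : {es : List (Edge n)} → Intersecting es →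
    nonemptyMatchingsOf es ≡ map [_] (reverse es)
  Intersecting⇒nonemptyMatchingsOf≡singletons {es = []}     []                  = refl
  Intersecting⇒nonemptyMatchingsOf≡singletons {es = e ∷ es} (e-meets ∷ es-meet) = begin
    nonemptyMatchingsOf es ++ [ e ] ∷ map (e ∷_) (filter (compatible? e) (nonemptyMatchingsOf es))
      ≡⟨ cong (λ Ms → Ms ++ [ e ] ∷ map (e ∷_) (filter (compatible? e) Ms)) ih ⟩
    map [_] (reverse es) ++ [ e ] ∷ map (e ∷_) (filter (compatible? e) (map [_] (reverse es)))
      ≡⟨ cong (λ Ms → map [_] (reverse es) ++ [ e ] ∷ map (e ∷_) Ms)
              (filter-none (compatible? e) incompatible) ⟩
    map [_] (reverse es) ++ map [_] [ e ]
      ≡⟨ map-++ [_] (reverse es) [ e ] ⟨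
    map [_] (reverse es ∷ʳ e)
      ≡⟨ cong (map [_]) (unfold-reverse e es) ⟨
    map [_] (reverse (e ∷ es)) ∎
    where
      open ≡-Reasoning
      ih = Intersecting⇒nonemptyMatchingsOf≡singletons es-meet
      incompatible : All (λ M → disjointAllᵇ e M ≢ true) (map [_] (reverse es))
      incompatible = All.map⁺ (All.tabulate λ f∈ →
        singleton-incompatible {e = e} (All.lookup e-meets (reverse⁻ f∈)))

  Intersecting⇒counts : {es : List (Edge n)} → Intersecting es →
    nonemptyCount es ≡ length es × nonemptySize es ≡ length es
  Intersecting⇒counts {es = es} es-meet =
    trans (cong length singletons) (trans (length-map [_] (reverse es)) (length-reverse es)) ,
    trans (cong Σlength singletons) (trans (Σlength-singletons (reverse es)) (length-reverse es))
    where singletons = Intersecting⇒nonemptyMatchingsOf≡singletons es-meet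

  numMatchings≡ : (G : Graph n) → numMatchings G ≡ suc (nonemptyCount (edges G))
  numMatchings≡ G = cong length (matchingsOf≡[]∷nonempty (edges G))

  totalMatchingSize≡ : (G : Graph n) → totalMatchingSize G ≡ nonemptySize (edges G)
  totalMatchingSize≡ G = cong Σlength (matchingsOf≡[]∷nonempty (edges G))

  Intersecting⇒numMatchings≡ : (G : Graph n) → Intersecting (edges G) → numMatchings G ≡ suc (length (edges G))
  Intersecting⇒numMatchings≡ G intersecting =
    trans (numMatchings≡ G) (cong suc (proj₁ (Intersecting⇒counts intersecting)))

  Intersecting⇒totalMatchingSize≡ : (G : Graph n) → Intersecting (edges G) →
    totalMatchingSize G ≡ length (edges G)
  Intersecting⇒totalMatchingSize≡ G intersecting =
    trans (totalMatchingSize≡ G) (proj₂ (Intersecting⇒counts intersecting))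

  k≤E⇒k*[1+E]≤E*[1+k] : ∀ {k E} → k ≤ E → k * suc E ≤ E * suc k
  k≤E⇒k*[1+E]≤E*[1+k] {k} {E} k≤E = begin
    k * suc E  ≡⟨ *-suc k E ⟩
    k + k * E  ≤⟨ +-monoˡ-≤ (k * E) k≤E ⟩
    E + k * E  ≡⟨ cong (E +_) (*-comm k E) ⟩
    E + E * k  ≡⟨ *-suc E k ⟨
    E * suc k  ∎
    where open ≤-Reasoning

  k*[1+E]≤E*[1+k]⇒k≤E : ∀ {k E} → k * suc E ≤ E * suc k → k ≤ E
  k*[1+E]≤E*[1+k]⇒k≤E {k} {E} h = +-cancelʳ-≤ (k * E) k E (begin
    k + k * E  ≡⟨ *-suc k E ⟨
    k * suc E  ≤⟨ h ⟩
    E * suc k  ≡⟨ *-suc E k ⟩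
    E + E * k  ≡⟨ cong (E +_) (*-comm E k) ⟩
    E + k * E  ∎)
    where open ≤-Reasoning

  k*[1+m]≤t*[1+k] : ∀ k E m t → E ≤ m → m + m ≤ E + t → (m ≤ E → k ≤ E) →
    (k * suc m ≤ t * suc k) × (k * suc m ≡ t * suc k → m ≤ E × E ≤ k)
  k*[1+m]≤t*[1+k] k E m t E≤m 2m≤E+t tight with m ≤? E
  ... | yes m≤E rewrite ≤-antisym m≤E E≤m =
    ≤-trans (k≤E⇒k*[1+E]≤E*[1+k] (tight ≤-refl)) E[1+k]≤t[1+k] ,
    λ same → ≤-refl , k*[1+E]≤E*[1+k]⇒k≤E (≤-trans E[1+k]≤t[1+k] (≤-reflexive (sym same)))
    where
      E[1+k]≤t[1+k] : E * suc k ≤ t * suc k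
      E[1+k]≤t[1+k] = *-monoˡ-≤ (suc k) (+-cancelˡ-≤ E E t 2m≤E+t)
  ... | no m≰E = <⇒≤ strict , λ same → ⊥-elim (<⇒≢ strict same)
    where
      m<t : m < t
      m<t = +-cancelˡ-< m m t (≤-<-trans 2m≤E+t (+-monoˡ-< t (≰⇒> m≰E)))
      strict : k * suc m < t * suc k
      strict = begin-strict
        k * suc m  ≤⟨ *-monoʳ-≤ k m<t ⟩
        k * t      <⟨ m<n+m (k * t) (≤-trans (s≤s z≤n) m<t) ⟩
        t + k * t  ≡⟨ cong (t +_) (*-comm k t) ⟩
        t + t * k  ≡⟨ *-suc t k ⟨
        t * suc k  ∎
        where open ≤-Reasoning

  _∈ₑ_ : Fin n → Edge n → Set
  x ∈ₑ (u , v) = x ≡ u ⊎ x ≡ v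

  Meet : Edge n → Edge n → Set
  Meet e f = ∃[ x ] x ∈ₑ e × x ∈ₑ f

  ∈ₑ-ends : {u v z : Fin n} {e : Edge n} →
    u ≢ v → u ∈ₑ e → v ∈ₑ e → z ∈ₑ e → z ∈ₑ (u , v)
  ∈ₑ-ends u≢v (inj₁ refl) (inj₁ refl) _  = ⊥-elim (u≢v refl)
  ∈ₑ-ends u≢v (inj₁ refl) (inj₂ refl) z∈ = z∈
  ∈ₑ-ends u≢v (inj₂ refl) (inj₁ refl) z∈ = Sum.swap z∈
  ∈ₑ-ends u≢v (inj₂ refl) (inj₂ refl) _  = ⊥-elim (u≢v refl)

  disjointᵇ≡false⇒Meet : (e f : Edge n) → disjointᵇ e f ≡ false → Meet e f
  disjointᵇ≡false⇒Meet (a , b) (c , d) h with a F.≟ c | a F.≟ d | b F.≟ c | b F.≟ d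
  ... | yes a≡c | _ | _ | _ = a , inj₁ refl , inj₁ a≡c
  ... | no _ | yes a≡d | _ | _ = a , inj₁ refl , inj₂ a≡d
  ... | no _ | no _ | yes b≡c | _ = b , inj₂ refl , inj₁ b≡c
  ... | no _ | no _ | no _ | yes b≡d = b , inj₂ refl , inj₂ b≡d
  disjointᵇ≡false⇒Meet (a , b) (c , d) () | no _ | no _ | no _ | no _

  record EdgeBetween (G : Graph n) (u v : Fin n) : Set where
    field
      edge   : Edge n
      edge∈  : edge ∈ edges G
      left∈  : u ∈ₑ edge
      right∈ : v ∈ₑ edge
  open EdgeBetween

  adj⇒≢ : (G : Graph n) {u v : Fin n} → adj G u v ≡ true → u ≢ v
  adj⇒≢ G {u} uv refl = not-¬ uv (irrefl G u)

  ordered∈edges : (G : Graph n) {u v : Fin n} → u F.< v → adj G u v ≡ true → (u , v) ∈ edges G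
  ordered∈edges G {u} {v} u<v uv =
    ∈-concatMap⁺ _ (Any.map (λ { refl → ∈-concatMap⁺ _ (Any.map (λ { refl → listed }) (∈-allFin v)) })
                            (∈-allFin u))
    where
      listed : (u , v) ∈ (if (F.toℕ u <ᵇ F.toℕ v) ∧ adj G u v then [ (u , v) ] else [])
      listed rewrite Equivalence.to T-≡ (<⇒<ᵇ u<v) | uv = here refl

  edgeBetween : (G : Graph n) {u v : Fin n} → adj G u v ≡ true → EdgeBetween G u v
  edgeBetween G {u} {v} uv with F.<-cmp u v
  ... | tri< u<v _ _ = record { edge = u , v ; edge∈ = ordered∈edges G u<v uv
                              ; left∈ = inj₁ refl ; right∈ = inj₂ refl }
  ... | tri≈ _ u≡v _ = ⊥-elim (adj⇒≢ G uv u≡v)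
  ... | tri> _ _ v<u = record { edge = v , u ; edge∈ = ordered∈edges G v<u (trans (Graph.sym G v u) uv)
                              ; left∈ = inj₂ refl ; right∈ = inj₁ refl }

  Meet-sym : {e f : Edge n} → Meet e f → Meet f e
  Meet-sym (z , z∈e , z∈f) = z , z∈f , z∈e

  EdgesMeet : Graph n → Set
  EdgesMeet {n} G = ∀ {u v x y : Fin n} → adj G u v ≡ true → adj G x y ≡ true → Meet (u , v) (x , y)

  Intersecting⇒EdgesMeet : (G : Graph n) → Intersecting (edges G) → EdgesMeet G
  Intersecting⇒EdgesMeet G intersecting uv xy =
    ends-meet (listed-meet (∈-AllPairs₂ intersecting (edge∈ e₁) (edge∈ e₂)))
    where
      e₁ = edgeBetween G uv
      e₂ = edgeBetween G xy
      listed-meet : edge e₁ ≡ edge e₂ ⊎ disjointᵇ (edge e₁) (edge e₂) ≡ false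
                                      ⊎ disjointᵇ (edge e₂) (edge e₁) ≡ false →
                    Meet (edge e₁) (edge e₂)
      listed-meet (inj₁ e₁≡e₂)       = _ , left∈ e₁ , subst (_ ∈ₑ_) e₁≡e₂ (left∈ e₁)
      listed-meet (inj₂ (inj₁ meet)) = disjointᵇ≡false⇒Meet _ _ meet
      listed-meet (inj₂ (inj₂ meet)) = Meet-sym (disjointᵇ≡false⇒Meet _ _ meet)
      ends-meet : Meet (edge e₁) (edge e₂) → Meet (_ , _) (_ , _)
      ends-meet (z , z∈₁ , z∈₂) =
        z , ∈ₑ-ends (adj⇒≢ G uv) (left∈ e₁) (right∈ e₁) z∈₁
          , ∈ₑ-ends (adj⇒≢ G xy) (left∈ e₂) (right∈ e₂) z∈₂

  injective⇒surjective : {m k : ℕ} {f : Fin m → Fin k} →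
    Injective _≡_ _≡_ f → k ≤ m → ∀ y → ∃[ x ] f x ≡ y
  injective⇒surjective {m} {k} {f} f-inj k≤m y with F.any? (λ x → f x F.≟ y)
  ... | yes hit = hit
  ... | no miss = ⊥-elim (<⇒≱ (F.injective⇒≤ g-inj) k≤m)
    where
      g : Fin (suc m) → Fin k
      g F.zero    = y
      g (F.suc x) = f x
      g-inj : Injective _≡_ _≡_ g
      g-inj {F.zero}  {F.zero}   _    = refl
      g-inj {F.zero}  {F.suc x'} y≡fx = ⊥-elim (miss (x' , sym y≡fx))
      g-inj {F.suc x} {F.zero}   fx≡y = ⊥-elim (miss (x , fx≡y))
      g-inj {F.suc x} {F.suc x'} eq   = cong F.suc (f-inj eq)

  index-injective : {xs : List A} {x y : A} (p : x ∈ xs) (q : y ∈ xs) → Any.index p ≡ Any.index q → x ≡ y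
  index-injective {xs = xs} p q same =
    trans (lookup-index p) (trans (cong (lookup xs) same) (sym (lookup-index q)))

  module Spokes {k : ℕ} (G : Graph (suc k)) (connected : Connected G) (meet : EdgesMeet G)
                {a b : Fin (suc k)} (ab : adj G a b ≡ true) where

    ba : adj G b a ≡ true
    ba = trans (Graph.sym G b a) ab

    adjacent-to-a-or-b : ∀ {w} → w ≢ a → adj G w a ≡ true ⊎ adj G w b ≡ true
    adjacent-to-a-or-b {w} w≢a with connected w a
    ... | here = ⊥-elim (w≢a refl)
    ... | step wx _ with meet wx ab
    ...   | _ , inj₁ refl , inj₁ refl = ⊥-elim (w≢a refl)
    ...   | _ , inj₁ refl , inj₂ refl = inj₁ ba
    ...   | _ , inj₂ refl , inj₁ refl = inj₁ wx
    ...   | _ , inj₂ refl , inj₂ refl = inj₂ wx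

    partner : Fin (suc k) → Fin (suc k)
    partner w = if adj G w a then a else b

    adj-partner : ∀ {w} → w ≢ a → adj G w (partner w) ≡ true
    adj-partner {w} w≢a with adj G w a in wa | adjacent-to-a-or-b w≢a
    ... | true  | _       = wa
    ... | false | inj₁ ()
    ... | false | inj₂ wb = wb

    ≡partner⇒≡b : ∀ {x} w → x ≢ a → x ≡ partner w → x ≡ b
    ≡partner⇒≡b w x≢a x≡p with adj G w a
    ... | true  = ⊥-elim (x≢a x≡p)
    ... | false = x≡p

    other : Fin k → Fin (suc k)
    other = F.punchIn a

    other≢a : ∀ j → other j ≢ a
    other≢a = F.punchInᵢ≢i a

    spokeEnds : Fin k → Edge (suc k)
    spokeEnds j = other j , partner (other j)

    spoke : (j : Fin k) → EdgeBetween G (other j) (partner (other j))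
    spoke j = edgeBetween G (adj-partner (other≢a j))

    spoke⊆spokeEnds : ∀ j {z} → z ∈ₑ edge (spoke j) → z ∈ₑ spokeEnds j
    spoke⊆spokeEnds j =
      ∈ₑ-ends (adj⇒≢ G (adj-partner (other≢a j))) (left∈ (spoke j)) (right∈ (spoke j))

    spokeEnds⊆spoke : ∀ j {z} → z ∈ₑ spokeEnds j → z ∈ₑ edge (spoke j)
    spokeEnds⊆spoke j (inj₁ refl) = left∈ (spoke j)
    spokeEnds⊆spoke j (inj₂ refl) = right∈ (spoke j)

    spokeIndex : Fin k → Fin (length (edges G))
    spokeIndex j = Any.index (edge∈ (spoke j))

    spokeIndex-injective : Injective _≡_ _≡_ spokeIndex
    spokeIndex-injective {i} {j} same =
      F.punchIn-injective a i j (same-vertex (spoke⊆spokeEnds i j∈spoke-i) (spoke⊆spokeEnds j i∈spoke-j))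
      where
        same-edge : edge (spoke i) ≡ edge (spoke j)
        same-edge = index-injective (edge∈ (spoke i)) (edge∈ (spoke j)) same
        j∈spoke-i : other j ∈ₑ edge (spoke i)
        j∈spoke-i = subst (other j ∈ₑ_) (sym same-edge) (left∈ (spoke j))
        i∈spoke-j : other i ∈ₑ edge (spoke j)
        i∈spoke-j = subst (other i ∈ₑ_) same-edge (left∈ (spoke i))
        same-vertex : other j ∈ₑ spokeEnds i → other i ∈ₑ spokeEnds j → other i ≡ other j
        same-vertex (inj₁ j≡i) _           = sym j≡i
        same-vertex _            (inj₁ i≡j) = i≡j
        same-vertex (inj₂ j≡partner-i)  (inj₂ i≡partner-j)  =
          trans (≡partner⇒≡b (other j) (other≢a i) i≡partner-j)
                (sym (≡partner⇒≡b (other i) (other≢a j) j≡partner-i))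

    k≤#edges : k ≤ length (edges G)
    k≤#edges = F.injective⇒≤ spokeIndex-injective

    module _ (#edges≤k : length (edges G) ≤ k) where

      edge-is-spoke : ∀ {u v} → adj G u v ≡ true →
        ∃[ j ] (∀ {c} → c ∈ₑ spokeEnds j → c ∈ₑ (u , v))
      edge-is-spoke uv =
        j , λ c∈ → ∈ₑ-ends (adj⇒≢ G uv) (left∈ e) (right∈ e) (subst (_ ∈ₑ_) spoke≡e (spokeEnds⊆spoke j c∈))
        where
          e = edgeBetween G uv
          found = injective⇒surjective spokeIndex-injective #edges≤k (Any.index (edge∈ e))
          j = proj₁ found
          spoke≡e : edge (spoke j) ≡ edge e
          spoke≡e = index-injective (edge∈ (spoke j)) (edge∈ e) (proj₂ found)

      IsStar-centredAt : ∀ c → (∀ v → v ≢ c → adj G c v ≡ true) → (∀ j → c ∈ₑ spokeEnds j) →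
        IsStar G
      IsStar-centredAt c c-adj c-on-spokes = c , c-adj , λ u v uv →
        let j , covers = edge-is-spoke uv in Sum.map sym sym (covers (c-on-spokes j))

      isStar : IsStar G
      isStar with F.any? (λ w → ¬? (w F.≟ a) ×-dec (adj G w a ≟ false))
      ... | no no-outlier = IsStar-centredAt a a-adj a-on-spokes
        where
          adj-a : ∀ {w} → w ≢ a → adj G w a ≡ true
          adj-a {w} w≢a with adj G w a in wa
          ... | true  = refl
          ... | false = ⊥-elim (no-outlier (w , w≢a , wa))
          a-adj : ∀ v → v ≢ a → adj G a v ≡ true
          a-adj v v≢a = trans (Graph.sym G a v) (adj-a v≢a)
          a-on-spokes : ∀ j → a ∈ₑ spokeEnds j
          a-on-spokes j rewrite adj-a (other≢a j) = inj₂ refl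
      ... | yes (w₀ , w₀≢a , w₀a) = IsStar-centredAt b b-adj b-on-spokes
        where
          w₀b : adj G w₀ b ≡ true
          w₀b with adjacent-to-a-or-b w₀≢a
          ... | inj₁ w₀a′ = ⊥-elim (not-¬ w₀a′ w₀a)
          ... | inj₂ w₀b  = w₀b
          adj-a⇒≡b : ∀ {w} → adj G w a ≡ true → w ≡ b
          adj-a⇒≡b wa with meet wa w₀b
          ... | _ , inj₁ refl , inj₁ refl = ⊥-elim (not-¬ wa w₀a)
          ... | _ , inj₁ refl , inj₂ refl = refl
          ... | _ , inj₂ refl , inj₁ refl = ⊥-elim (w₀≢a refl)
          ... | _ , inj₂ refl , inj₂ refl = ⊥-elim (adj⇒≢ G ab refl)
          b-adj : ∀ v → v ≢ b → adj G b v ≡ true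
          b-adj v v≢b with v F.≟ a
          ... | yes refl = ba
          ... | no v≢a with adjacent-to-a-or-b v≢a
          ...   | inj₁ va = ⊥-elim (v≢b (adj-a⇒≡b va))
          ...   | inj₂ vb = trans (Graph.sym G b v) vb
          b-on-spokes : ∀ j → b ∈ₑ spokeEnds j
          b-on-spokes j with adj G (other j) a in wa
          ... | true  = inj₁ (sym (adj-a⇒≡b wa))
          ... | false = inj₂ refl

  connected-intersecting-edges : ∀ k (G : Graph (suc k)) → Connected G → Intersecting (edges G) →
    k ≤ length (edges G) × (length (edges G) ≤ k → IsStar G)
  connected-intersecting-edges zero G _ _ =
    z≤n , λ _ → F.zero , (λ { F.zero 0≢0 → ⊥-elim (0≢0 refl) }) , λ { F.zero _ _ → inj₁ refl }
  connected-intersecting-edges (suc k) G connected intersecting with connected F.zero (F.suc F.zero)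
  ... | step ab _ = Spokes.k≤#edges G connected meet ab , Spokes.isStar G connected meet ab
    where meet = Intersecting⇒EdgesMeet G intersecting

  concatMap-tabulate-singletons : {B : Set} {m : ℕ} {f : A → List B} {g : Fin m → A} {h : Fin m → B} →
    (∀ j → f (g j) ≡ [ h j ]) → concatMap f (tabulate g) ≡ tabulate h
  concatMap-tabulate-singletons {m = zero}  fg≡h = refl
  concatMap-tabulate-singletons {m = suc m} fg≡h =
    cong₂ _++_ (fg≡h F.zero) (concatMap-tabulate-singletons (fg≡h ∘ F.suc))

  concatMap-tabulate-empty : {B : Set} {m : ℕ} {f : A → List B} {g : Fin m → A} →
    (∀ j → f (g j) ≡ []) → concatMap f (tabulate g) ≡ []
  concatMap-tabulate-empty {m = zero}  fg≡[] = refl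
  concatMap-tabulate-empty {m = suc m} fg≡[] =
    cong₂ _++_ (fg≡[] F.zero) (concatMap-tabulate-empty (fg≡[] ∘ F.suc))

  star-edges : ∀ k → edges (star (suc k)) ≡ tabulate (λ (j : Fin k) → (F.zero , F.suc j))
  star-edges k = begin
    concatMap row (allFin (suc k))
      ≡⟨ cong₂ _++_ (concatMap-tabulate-singletons (λ _ → refl))
                    (concatMap-tabulate-empty (λ i → concatMap-tabulate-empty (λ j → leaf-empty i j))) ⟩
    tabulate (λ j → (F.zero , F.suc j)) ++ []
      ≡⟨ ++-identityʳ _ ⟩
    tabulate (λ j → (F.zero , F.suc j)) ∎
    where
      open ≡-Reasoning
      entry : Fin (suc k) → Fin (suc k) → List (Edge (suc k))
      entry u v = if (F.toℕ u <ᵇ F.toℕ v) ∧ starAdj u v then [ (u , v) ] else []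
      row : Fin (suc k) → List (Edge (suc k))
      row u = concatMap (entry u) (allFin (suc k))
      leaf-empty : ∀ i j → entry (F.suc i) (F.suc j) ≡ []
      leaf-empty i j rewrite ∧-zeroʳ (F.toℕ (F.suc i) <ᵇ F.toℕ (F.suc j)) = refl

  star-intersecting : ∀ k → Intersecting (edges (star (suc k)))
  star-intersecting k = subst Intersecting (sym (star-edges k)) (AllPairs.tabulate⁺ (λ _ → refl))

  star-#edges : ∀ k → length (edges (star (suc k))) ≡ k
  star-#edges k = trans (cong length (star-edges k)) (length-tabulate _)

  star-numMatchings : ∀ k → numMatchings (star (suc k)) ≡ suc k
  star-numMatchings k =
    trans (Intersecting⇒numMatchings≡ (star (suc k)) (star-intersecting k)) (cong suc (star-#edges k))

  star-totalMatchingSize : ∀ k → totalMatchingSize (star (suc k)) ≡ k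
  star-totalMatchingSize k =
    trans (Intersecting⇒totalMatchingSize≡ (star (suc k)) (star-intersecting k)) (star-#edges k)

  cross-multiplied-bound : ∀ k (G : Graph (suc k)) → Connected G →
    let S = star (suc k) in
    (totalMatchingSize S * numMatchings G ≤ totalMatchingSize G * numMatchings S) ×
    (totalMatchingSize S * numMatchings G ≡ totalMatchingSize G * numMatchings S → IsStar G)
  cross-multiplied-bound k G connected =
    subst₂ _≤_ (sym lhs) (sym rhs) (proj₁ bound) ,
    λ same → let tight , #edges≤k = proj₂ bound (trans (sym lhs) (trans same rhs))
             in proj₂ (graph tight) #edges≤k
    where
      es = edges G
      graph : nonemptyCount es ≤ length es → k ≤ length es × (length es ≤ k → IsStar G)
      graph tight = connected-intersecting-edges k G connected (nonemptyCount≤length⇒Intersecting es tight)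
      bound = k*[1+m]≤t*[1+k] k (length es) (nonemptyCount es) (nonemptySize es)
                (length≤nonemptyCount es) (nonemptyCount-double≤ es) (proj₁ ∘ graph)
      lhs : totalMatchingSize (star (suc k)) * numMatchings G ≡ k * suc (nonemptyCount es)
      lhs = cong₂ _*_ (star-totalMatchingSize k) (numMatchings≡ G)
      rhs : totalMatchingSize G * numMatchings (star (suc k)) ≡ nonemptySize es * suc k
      rhs = cong₂ _*_ (totalMatchingSize≡ G) (star-numMatchings k)

  -- ℚ's _/_ normalises by the gcd; the cross-multiplied inequality is read off the
  -- unnormalised fractions, which toℚᵘ ∘ fromℚᵘ preserves up to ≃.
  /-mono-cross : ∀ m c n d .{{_ : NonZero c}} .{{_ : NonZero d}} →
    m * d ≤ n * c → (ℤ.+ m) ℚ./ c ℚ.≤ (ℤ.+ n) ℚ./ d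
  /-mono-cross m (suc c) n (suc d) h = toℚᵘ-cancel-≤
    (ℚᵘ.≤-respʳ-≃ (ℚᵘ.≃-sym (toℚᵘ-fromℚᵘ (ℚᵘ.mkℚᵘ (ℤ.+ n) d)))
      (ℚᵘ.≤-respˡ-≃ (ℚᵘ.≃-sym (toℚᵘ-fromℚᵘ (ℚᵘ.mkℚᵘ (ℤ.+ m) c)))
        (ℚᵘ.*≤* (subst₂ ℤ._≤_ (ℤ.pos-* m (suc d)) (ℤ.pos-* n (suc c)) (ℤ.+≤+ h)))))

  av-≤ : ∀ {m} (H : Graph n) (G : Graph m) →
    totalMatchingSize H * numMatchings G ≤ totalMatchingSize G * numMatchings H → av H ℚ.≤ av G
  av-≤ H G = /-mono-cross (totalMatchingSize H) (numMatchings H) (totalMatchingSize G) (numMatchings G)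
    {{numMatchingsOf-nonZero (edges H)}} {{numMatchingsOf-nonZero (edges G)}}

  av-≡ : ∀ {m} (H : Graph n) (G : Graph m) →
    av H ≡ av G → totalMatchingSize H * numMatchings G ≡ totalMatchingSize G * numMatchings H
  av-≡ H G =
    normalize-injective-≃ (totalMatchingSize H) (totalMatchingSize G) (numMatchings H) (numMatchings G)
    {{numMatchingsOf-nonZero (edges H)}} {{numMatchingsOf-nonZero (edges G)}}

open AverageMatchingSize using (cross-multiplied-bound; av-≤; av-≡)

open import Defs
open import Data.Nat using (ℕ; NonZero; suc)
open import Data.Rational using (_≤_)
open import Relation.Binary.PropositionalEquality using (_≡_)
open import Data.Product using (_×_; _,_; proj₁; proj₂)

mainTheorem8 : (n : ℕ) → .{{_ : NonZero n}} → (G : Graph n) → Connected G →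
    (av (star n) ≤ av G) × (av (star n) ≡ av G → IsStar G)
mainTheorem8 (suc k) G connected =
  av-≤ (star (suc k)) G (proj₁ bound) , λ same → proj₂ bound (av-≡ (star (suc k)) G same)
  where bound = cross-multiplied-bound k G connected
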